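{- Let $X$ be an $m\times m$ matrix whose entries are independent and uniformly distributed on $\{1,-1\}$. Then, with probability tending to $1$ as $m\to\infty$, $X$ does not contain an $r\times s$ submatrix $Y$ such that $r+s=m+2$ and $\operatorname{rank}Y=1$. -}

module Defs where

open import Data.Bool using (Bool; true; false)
open import Data.Nat using (ℕ; _+_; _*_; _∸_; _^_; _≤_)
open import Data.Fin using (Fin) renaming (_<_ to _<ᶠ_)
open import Data.Vec using (Vec; lookup)
open import Data.Rational using (ℚ; 0ℚ; 1ℚ; -_) renaming (_*_ to _*ℚ_)
open import Data.Product using (Σ; ∃; ∃-syntax; _×_)
open import Data.List using (List; length)
open import Data.List.Relation.Unary.All using (All)
open import Data.List.Relation.Unary.Unique.Propositional using (Unique)
open import Relation.Binary.PropositionalEquality using (_≡_; _≢_)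
open import Relation.Nullary using (¬_)

val : Bool → ℚ
val true  = 1ℚ
val false = - 1ℚ

SignMatrix : ℕ → Set
SignMatrix m = Vec (Vec Bool m) m

entry : ∀ {m} → SignMatrix m → Fin m → Fin m → ℚ
entry X i j = val (lookup (lookup X i) j)

StrictlyIncreasing : ∀ {r m} → (Fin r → Fin m) → Set
StrictlyIncreasing f = ∀ i j → i <ᶠ j → f i <ᶠ f j

RankOne : ∀ {r s} → (Fin r → Fin s → ℚ) → Set
RankOne {r} {s} Y =
  (Σ (Fin r) λ i → Σ (Fin s) λ j → Y i j ≢ 0ℚ) ×
  (Σ (Fin r → ℚ) λ u → Σ (Fin s → ℚ) λ v → (∀ i j → Y i j ≡ (u i *ℚ v j)))

ContainsBadSubmatrix : ∀ m → SignMatrix m → Set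
ContainsBadSubmatrix m X =
  ∃[ r ] ∃[ s ] (r + s ≡ m + 2) ×
    (Σ (Fin r → Fin m) λ ρ → Σ (Fin s → Fin m) λ σ →
      StrictlyIncreasing ρ × StrictlyIncreasing σ ×
      RankOne (λ i j → entry X (ρ i) (σ j)))

-- "with probability ≥ 1 - 1/k, X is good" under the uniform distribution:
-- at least (1 - 1/k)·2^(m²) distinct matrices avoid a bad submatrix.
ProbGoodAtLeast : ℕ → ℕ → Set
ProbGoodAtLeast k m =
  ∃[ L ] Unique {A = SignMatrix m} L ×
    All (λ X → ¬ ContainsBadSubmatrix m X) L ×
    ((k ∸ 1) * 2 ^ (m * m) ≤ k * length L)

-- A rank-one r × s submatrix with r + s = m + 2 may be assumed (transposing if necessary) to
-- have s ≤ r, so s ≥ 2 and 2r ≥ m + 2; its rows are proportional, so all r rows show the same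
-- sign pattern on any two or three of its columns. Call such a choice of distinct columns and
-- target parities a test, and weigh each row of the matrix by 4 if it passes the test and by 1
-- otherwise. The product of the row weights is then at least 4^r, which is 4^m if s = 2 and at
-- least 2^(m+2) if s ≥ 3. Rows are independent, so the product averages (5/2)^m over all
-- matrices for a two-column test and (7/4)^m for a three-column test. Hence the potential
-- 4 · (two-column products) + 2^m · (three-column products), summed over the O(m³) tests,
-- reaches 4^(m+1) on a bad matrix or on its transpose, while its average is O(m³ (7/8)^m 4^(m+1));
-- Markov's inequality bounds the proportion of bad matrices by O(m³ (7/8)^m).

module Submission where

open import Defs
open import Data.Bool using (Bool; true; false; not; _xor_; _∧_)
open import Data.Bool.Properties using (not-distribʳ-xor; not-injective; xor-same) renaming (_≟_ to _≟ᵇ_)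
open import Data.Nat using (ℕ; zero; suc; _+_; _*_; _∸_; _^_; _≤_; z≤n; s≤s; _≤?_; >-nonZero)
open import Data.Nat.Properties
open import Algebra.Properties.CommutativeSemigroup *-commutativeSemigroup using () renaming (x∙yz≈y∙xz to *-left-comm)
open import Data.Nat.Tactic.RingSolver using (solve-∀)
open import Data.Fin using (Fin; zero; suc; punchIn; punchOut)
open import Data.Fin.Properties using (any?; punchIn-injective; punchInᵢ≢i; punchIn-punchOut; injective⇒≤)
  renaming (_≟_ to _≟ᶠ_; <-cmp to <ᶠ-cmp; <⇒≢ to <ᶠ⇒≢)
open import Data.Vec using (Vec; []; _∷_; lookup; zipWith; transpose; _[_]%=_)
open import Data.Vec.Properties using (∷-injective; lookup-zipWith; zipWith-is-⊛; lookup∘updateAt; lookup∘updateAt′)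
open import Data.List using (List; []; _∷_; _++_; map; length; filter; cartesianProductWith; cartesianProduct; allFin)
open import Data.List.Properties using (length-filter; length-tabulate)
open import Data.List.Membership.Propositional using (_∈_)
open import Data.List.Membership.Propositional.Properties
  using (∈-cartesianProduct⁺; ∈-cartesianProduct⁻; ∈-filter⁺; ∈-filter⁻; ∈-allFin)
open import Data.List.Relation.Unary.All as All using (All; []; _∷_)
open import Data.List.Relation.Unary.All.Properties using (all-filter)
open import Data.List.Relation.Unary.AllPairs using ([]; _∷_)
open import Data.List.Relation.Unary.Any using (here; there)
open import Data.List.Relation.Unary.Unique.Propositional using (Unique)
open import Data.List.Relation.Unary.Unique.Propositional.Properties using (cartesianProductWith⁺; filter⁺)
open import Data.Product using (Σ; ∃-syntax; _×_; _,_; proj₁; proj₂)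
open import Data.Rational using (ℚ; 1ℚ) renaming (_*_ to _*ℚ_)
open import Data.Rational.Properties using () renaming (*-identityʳ to *ℚ-identityʳ; *-comm to *ℚ-comm)
open import Function using (_∘_)
open import Function.Definitions using (Injective)
open import Relation.Binary.PropositionalEquality
open import Relation.Binary.Definitions using (tri<; tri≈; tri>)
open import Relation.Nullary using (Dec; yes; no; does; contradiction)
open import Relation.Nullary.Decidable using (dec-true; ¬?; _×-dec_)
import Relation.Unary as U
open import Relation.Unary.Properties using (∁?)

private
  variable
    A B C T : Set
    k m n r s : ℕ

∑ : List A → (A → ℕ) → ℕ
∑ []       f = 0
∑ (x ∷ xs) f = f x + ∑ xs f

syntax ∑ xs (λ x → e) = ∑[ x ← xs ] e

∑-cong : ∀ (xs : List A) {f g : A → ℕ} → (∀ x → f x ≡ g x) → ∑ xs f ≡ ∑ xs g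
∑-cong []       f≗g = refl
∑-cong (x ∷ xs) f≗g = cong₂ _+_ (f≗g x) (∑-cong xs f≗g)

∑-cong-All : ∀ {xs : List A} {f g : A → ℕ} → All (λ x → f x ≡ g x) xs → ∑ xs f ≡ ∑ xs g
∑-cong-All []             = refl
∑-cong-All (fx≡gx ∷ f≗g) = cong₂ _+_ fx≡gx (∑-cong-All f≗g)

∑-++ : ∀ (xs ys : List A) (f : A → ℕ) → ∑ (xs ++ ys) f ≡ ∑ xs f + ∑ ys f
∑-++ []       ys f = refl
∑-++ (x ∷ xs) ys f = trans (cong (f x +_) (∑-++ xs ys f)) (sym (+-assoc (f x) _ _))

∑-map : ∀ (h : A → B) (xs : List A) (f : B → ℕ) → ∑ (map h xs) f ≡ ∑ xs (f ∘ h)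
∑-map h []       f = refl
∑-map h (x ∷ xs) f = cong (f (h x) +_) (∑-map h xs f)

∑-+ : ∀ (xs : List A) (f g : A → ℕ) → ∑[ x ← xs ] (f x + g x) ≡ ∑ xs f + ∑ xs g
∑-+ []       f g = refl
∑-+ (x ∷ xs) f g = trans (cong (f x + g x +_) (∑-+ xs f g)) (+-+-exch (f x) (g x) _ _)
  where
  +-+-exch : ∀ a b c d → a + b + (c + d) ≡ a + c + (b + d)
  +-+-exch = solve-∀

∑-*ˡ : ∀ (xs : List A) (c : ℕ) (f : A → ℕ) → ∑[ x ← xs ] (c * f x) ≡ c * ∑ xs f
∑-*ˡ []       c f = sym (*-zeroʳ c)
∑-*ˡ (x ∷ xs) c f = trans (cong (c * f x +_) (∑-*ˡ xs c f)) (sym (*-distribˡ-+ c (f x) _))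

∑-const : ∀ (xs : List A) (c : ℕ) → ∑[ _ ← xs ] c ≡ c * length xs
∑-const []       c = sym (*-zeroʳ c)
∑-const (x ∷ xs) c = trans (cong (c +_) (∑-const xs c)) (sym (*-suc c (length xs)))

length≡∑1 : ∀ (xs : List A) → length xs ≡ ∑[ _ ← xs ] 1
length≡∑1 xs = sym (trans (∑-const xs 1) (*-identityˡ _))

∑-swap : ∀ (xs : List A) (ys : List B) (f : A → B → ℕ) →
         ∑[ x ← xs ] ∑[ y ← ys ] f x y ≡ ∑[ y ← ys ] ∑[ x ← xs ] f x y
∑-swap []       ys f = sym (trans (∑-const ys 0) (*-zeroˡ (length ys)))
∑-swap (x ∷ xs) ys f =
  trans (cong (∑ ys (f x) +_) (∑-swap xs ys f)) (sym (∑-+ ys (f x) (λ y → ∑[ x ← xs ] f x y)))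

∑-cartesianProductWith : ∀ (h : A → B → C) (xs : List A) (ys : List B) (f : C → ℕ) →
  ∑ (cartesianProductWith h xs ys) f ≡ ∑[ x ← xs ] ∑[ y ← ys ] f (h x y)
∑-cartesianProductWith h []       ys f = refl
∑-cartesianProductWith h (x ∷ xs) ys f = begin
  ∑ (map (h x) ys ++ cartesianProductWith h xs ys) f
    ≡⟨ ∑-++ (map (h x) ys) _ f ⟩
  ∑ (map (h x) ys) f + ∑ (cartesianProductWith h xs ys) f
    ≡⟨ cong₂ _+_ (∑-map (h x) ys f) (∑-cartesianProductWith h xs ys f) ⟩
  ∑[ y ← ys ] f (h x y) + ∑[ x ← xs ] ∑[ y ← ys ] f (h x y) ∎
  where open ≡-Reasoning

length-cartesianProductWith : ∀ (h : A → B → C) (xs : List A) (ys : List B) →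
  length (cartesianProductWith h xs ys) ≡ length xs * length ys
length-cartesianProductWith h xs ys = begin
  length (cartesianProductWith h xs ys)    ≡⟨ length≡∑1 (cartesianProductWith h xs ys) ⟩
  ∑[ _ ← cartesianProductWith h xs ys ] 1 ≡⟨ ∑-cartesianProductWith h xs ys _ ⟩
  ∑[ _ ← xs ] ∑[ _ ← ys ] 1               ≡⟨ ∑-cong xs (λ _ → sym (length≡∑1 ys)) ⟩
  ∑[ _ ← xs ] length ys                    ≡⟨ ∑-const xs _ ⟩
  length ys * length xs                    ≡⟨ *-comm (length ys) _ ⟩
  length xs * length ys                    ∎
  where open ≡-Reasoning

∈⇒≤∑ : ∀ {xs : List A} {x} (f : A → ℕ) → x ∈ xs → f x ≤ ∑ xs f
∈⇒≤∑ f (here refl) = m≤m+n _ _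
∈⇒≤∑ f (there x∈xs) = ≤-trans (∈⇒≤∑ f x∈xs) (m≤n+m _ _)

allVecs : List A → (k : ℕ) → List (Vec A k)
allVecs xs zero    = [] ∷ []
allVecs xs (suc k) = cartesianProductWith _∷_ xs (allVecs xs k)

allVecs-unique : ∀ {xs : List A} k → Unique xs → Unique (allVecs xs k)
allVecs-unique zero    _      = [] ∷ []
allVecs-unique (suc k) xs-uniq = cartesianProductWith⁺ _∷_ ∷-injective xs-uniq (allVecs-unique k xs-uniq)

∑-allVecs-suc : ∀ (xs : List A) k (f : Vec A (suc k) → ℕ) →
  ∑ (allVecs xs (suc k)) f ≡ ∑[ x ← xs ] ∑[ v ← allVecs xs k ] f (x ∷ v)
∑-allVecs-suc xs k = ∑-cartesianProductWith _∷_ xs (allVecs xs k)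

∏ : (A → ℕ) → Vec A k → ℕ
∏ g []       = 1
∏ g (x ∷ xs) = g x * ∏ g xs

∑-∏ : ∀ (xs : List A) (g : A → ℕ) k → ∑[ v ← allVecs xs k ] ∏ g v ≡ ∑ xs g ^ k
∑-∏ xs g zero    = refl
∑-∏ xs g (suc k) = begin
  ∑ (allVecs xs (suc k)) (∏ g)                    ≡⟨ ∑-allVecs-suc xs k (∏ g) ⟩
  ∑[ x ← xs ] ∑[ v ← allVecs xs k ] (g x * ∏ g v) ≡⟨ ∑-cong xs (λ x → ∑-*ˡ (allVecs xs k) (g x) (∏ g)) ⟩
  ∑[ x ← xs ] (g x * ∑ (allVecs xs k) (∏ g))     ≡⟨ ∑-cong xs (λ x → *-comm (g x) _) ⟩
  ∑[ x ← xs ] (∑ (allVecs xs k) (∏ g) * g x)     ≡⟨ ∑-*ˡ xs (∑ (allVecs xs k) (∏ g)) g ⟩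
  ∑ (allVecs xs k) (∏ g) * ∑ xs g                 ≡⟨ cong (_* ∑ xs g) (∑-∏ xs g k) ⟩
  ∑ xs g ^ k * ∑ xs g                             ≡⟨ *-comm (∑ xs g ^ k) _ ⟩
  ∑ xs g ^ suc k                                  ∎
  where open ≡-Reasoning

length-allVecs : ∀ (xs : List A) k → length (allVecs xs k) ≡ length xs ^ k
length-allVecs xs k = begin
  length (allVecs xs k)         ≡⟨ length≡∑1 (allVecs xs k) ⟩
  ∑[ v ← allVecs xs k ] 1       ≡⟨ ∑-cong (allVecs xs k) (λ v → sym (∏-1 v)) ⟩
  ∑[ v ← allVecs xs k ] ∏ _ v   ≡⟨ ∑-∏ xs (λ _ → 1) k ⟩
  (∑[ _ ← xs ] 1) ^ k           ≡⟨ cong (_^ k) (sym (length≡∑1 xs)) ⟩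
  length xs ^ k                 ∎
  where
  open ≡-Reasoning
  ∏-1 : ∀ {k} (v : Vec A k) → ∏ (λ _ → 1) v ≡ 1
  ∏-1 []      = refl
  ∏-1 (_ ∷ v) = cong (1 *_) (∏-1 v)

bools : List Bool
bools = true ∷ false ∷ []

∈-bools : ∀ b → b ∈ bools
∈-bools true  = here refl
∈-bools false = there (here refl)

boolVecs : ∀ n → List (Vec Bool n)
boolVecs = allVecs bools

signMatrices : ∀ m n → List (Vec (Vec Bool n) m)
signMatrices m n = allVecs (boolVecs n) m

length-boolVecs : ∀ n → length (boolVecs n) ≡ 2 ^ n
length-boolVecs = length-allVecs bools

length-signMatrices : ∀ m → length (signMatrices m m) ≡ 2 ^ (m * m)
length-signMatrices m = begin
  length (signMatrices m m) ≡⟨ length-allVecs (boolVecs m) m ⟩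
  length (boolVecs m) ^ m   ≡⟨ cong (_^ m) (length-boolVecs m) ⟩
  (2 ^ m) ^ m               ≡⟨ ^-*-assoc 2 m m ⟩
  2 ^ (m * m)               ∎
  where open ≡-Reasoning

signMatrices-unique : ∀ m n → Unique (signMatrices m n)
signMatrices-unique m n = allVecs-unique m (allVecs-unique n (((λ ()) ∷ []) ∷ [] ∷ []))

transpose-∷ : ∀ (v : Vec A n) (M : Vec (Vec A n) m) → transpose (v ∷ M) ≡ zipWith _∷_ v (transpose M)
transpose-∷ v M = sym (zipWith-is-⊛ _∷_ v (transpose M))

transpose-zipWith-∷ : ∀ (v : Vec A n) (M : Vec (Vec A m) n) →
                      transpose (zipWith _∷_ v M) ≡ v ∷ transpose M
transpose-zipWith-∷ []      []      = refl
transpose-zipWith-∷ (x ∷ v) (u ∷ M) = begin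
  transpose ((x ∷ u) ∷ zipWith _∷_ v M)              ≡⟨ transpose-∷ (x ∷ u) (zipWith _∷_ v M) ⟩
  zipWith _∷_ (x ∷ u) (transpose (zipWith _∷_ v M)) ≡⟨ cong (zipWith _∷_ (x ∷ u)) (transpose-zipWith-∷ v M) ⟩
  (x ∷ v) ∷ zipWith _∷_ u (transpose M)              ≡⟨ cong ((x ∷ v) ∷_) (transpose-∷ u M) ⟨
  (x ∷ v) ∷ transpose (u ∷ M)                        ∎
  where open ≡-Reasoning

lookup-transpose : ∀ (M : Vec (Vec A n) m) i j → lookup (lookup (transpose M) j) i ≡ lookup (lookup M i) j
lookup-transpose (v ∷ M) i j = begin
  lookup (lookup (transpose (v ∷ M)) j) i                ≡⟨ cong (λ N → lookup (lookup N j) i) (transpose-∷ v M) ⟩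
  lookup (lookup (zipWith _∷_ v (transpose M)) j) i      ≡⟨ cong (λ u → lookup u i) (lookup-zipWith _∷_ j v (transpose M)) ⟩
  lookup (lookup v j ∷ lookup (transpose M) j) i         ≡⟨ lookup-∷ i ⟩
  lookup (lookup (v ∷ M) i) j                            ∎
  where
  open ≡-Reasoning
  lookup-∷ : ∀ i → lookup (lookup v j ∷ lookup (transpose M) j) i ≡ lookup (lookup (v ∷ M) i) j
  lookup-∷ zero    = refl
  lookup-∷ (suc i) = lookup-transpose M i j

∑-firstColumn : ∀ (xs : List A) m n (f : Vec (Vec A (suc m)) n → ℕ) →
  ∑ (allVecs (allVecs xs (suc m)) n) f ≡
  ∑[ v ← allVecs xs n ] ∑[ M ← allVecs (allVecs xs m) n ] f (zipWith _∷_ v M)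
∑-firstColumn xs m zero    f = cong (_+ 0) (sym (+-identityʳ (f [])))
∑-firstColumn xs m (suc n) f = begin
  ∑ (allVecs (allVecs xs (suc m)) (suc n)) f
    ≡⟨ ∑-allVecs-suc (allVecs xs (suc m)) n f ⟩
  ∑[ u ← allVecs xs (suc m) ] ∑[ N ← allVecs (allVecs xs (suc m)) n ] f (u ∷ N)
    ≡⟨ ∑-allVecs-suc xs m _ ⟩
  ∑[ x ← xs ] ∑[ u ← allVecs xs m ] ∑[ N ← allVecs (allVecs xs (suc m)) n ] f ((x ∷ u) ∷ N)
    ≡⟨ ∑-cong xs (λ x → ∑-cong (allVecs xs m) (λ u → ∑-firstColumn xs m n _)) ⟩
  ∑[ x ← xs ] ∑[ u ← allVecs xs m ] ∑[ v ← allVecs xs n ] ∑[ M ← allVecs (allVecs xs m) n ]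
    f ((x ∷ u) ∷ zipWith _∷_ v M)
    ≡⟨ ∑-cong xs (λ x → ∑-swap (allVecs xs m) (allVecs xs n) _) ⟩
  ∑[ x ← xs ] ∑[ v ← allVecs xs n ] ∑[ u ← allVecs xs m ] ∑[ M ← allVecs (allVecs xs m) n ]
    f ((x ∷ u) ∷ zipWith _∷_ v M)
    ≡⟨ ∑-cong xs (λ x → ∑-cong (allVecs xs n) (λ v → ∑-allVecs-suc (allVecs xs m) n (λ M → f (zipWith _∷_ (x ∷ v) M)))) ⟨
  ∑[ x ← xs ] ∑[ v ← allVecs xs n ] ∑[ M ← allVecs (allVecs xs m) (suc n) ] f (zipWith _∷_ (x ∷ v) M)
    ≡⟨ ∑-allVecs-suc xs n _ ⟨
  ∑[ v ← allVecs xs (suc n) ] ∑[ M ← allVecs (allVecs xs m) (suc n) ] f (zipWith _∷_ v M) ∎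
  where open ≡-Reasoning

∑-transpose : ∀ (xs : List A) m n (f : Vec (Vec A n) m → ℕ) →
  ∑ (allVecs (allVecs xs n) m) f ≡ ∑[ M ← allVecs (allVecs xs m) n ] f (transpose M)
∑-transpose xs zero n f = sym (begin
  ∑[ M ← allVecs (allVecs xs 0) n ] f (transpose M)
    ≡⟨ ∑-cong (allVecs (allVecs xs 0) n) (λ M → cong f (Vec₀-[] (transpose M))) ⟩
  ∑[ _ ← allVecs (allVecs xs 0) n ] f []           ≡⟨ ∑-const (allVecs (allVecs xs 0) n) (f []) ⟩
  f [] * length (allVecs (allVecs xs 0) n)        ≡⟨ cong (f [] *_) (trans (length-allVecs _ n) (^-zeroˡ n)) ⟩
  f [] * 1                                        ≡⟨ *-identityʳ (f []) ⟩
  f []                                            ≡⟨ +-identityʳ (f []) ⟨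
  ∑ (allVecs (allVecs xs n) 0) f                  ∎)
  where
  open ≡-Reasoning
  Vec₀-[] : (v : Vec B 0) → v ≡ []
  Vec₀-[] [] = refl
∑-transpose xs (suc m) n f = begin
  ∑ (allVecs (allVecs xs n) (suc m)) f
    ≡⟨ ∑-allVecs-suc (allVecs xs n) m f ⟩
  ∑[ v ← allVecs xs n ] ∑[ M ← allVecs (allVecs xs n) m ] f (v ∷ M)
    ≡⟨ ∑-cong (allVecs xs n) (λ v → ∑-transpose xs m n _) ⟩
  ∑[ v ← allVecs xs n ] ∑[ M ← allVecs (allVecs xs m) n ] f (v ∷ transpose M)
    ≡⟨ ∑-cong (allVecs xs n) (λ v → ∑-cong (allVecs (allVecs xs m) n) (λ M → cong f (transpose-zipWith-∷ v M))) ⟨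
  ∑[ v ← allVecs xs n ] ∑[ M ← allVecs (allVecs xs m) n ] f (transpose (zipWith _∷_ v M))
    ≡⟨ ∑-firstColumn xs m n _ ⟨
  ∑[ M ← allVecs (allVecs xs (suc m)) n ] f (transpose M) ∎
  where open ≡-Reasoning

-- Averages over the Boolean cube

∑-flip : ∀ (i : Fin n) (f : Vec Bool n → ℕ) → ∑ (boolVecs n) f ≡ ∑[ v ← boolVecs n ] f (v [ i ]%= not)
∑-flip {suc n} zero f = begin
  ∑ (boolVecs (suc n)) f
    ≡⟨ ∑-allVecs-suc bools n f ⟩
  ∑[ v ← boolVecs n ] f (true ∷ v) + (∑[ v ← boolVecs n ] f (false ∷ v) + 0)
    ≡⟨ +-swap (∑[ v ← boolVecs n ] f (true ∷ v)) _ ⟩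
  ∑[ v ← boolVecs n ] f (false ∷ v) + (∑[ v ← boolVecs n ] f (true ∷ v) + 0)
    ≡⟨ ∑-allVecs-suc bools n _ ⟨
  ∑[ v ← boolVecs (suc n) ] f (v [ zero ]%= not) ∎
  where
  open ≡-Reasoning
  +-swap : ∀ a b → a + (b + 0) ≡ b + (a + 0)
  +-swap = solve-∀
∑-flip {suc n} (suc i) f = begin
  ∑ (boolVecs (suc n)) f                                         ≡⟨ ∑-allVecs-suc bools n f ⟩
  ∑[ x ← bools ] ∑[ v ← boolVecs n ] f (x ∷ v)                   ≡⟨ ∑-cong bools (λ x → ∑-flip i (λ v → f (x ∷ v))) ⟩
  ∑[ x ← bools ] ∑[ v ← boolVecs n ] f (x ∷ (v [ i ]%= not))     ≡⟨ ∑-allVecs-suc bools n _ ⟨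
  ∑[ v ← boolVecs (suc n) ] f (v [ suc i ]%= not)                ∎
  where open ≡-Reasoning

∑-toggle : ∀ (i : Fin n) (c : Vec Bool n → Bool) → (∀ v → c (v [ i ]%= not) ≡ not (c v)) →
           (f : Bool → Vec Bool n → ℕ) → (∀ b v → f b (v [ i ]%= not) ≡ f b v) →
           2 * ∑[ v ← boolVecs n ] f (c v) v ≡ ∑[ v ← boolVecs n ] (f true v + f false v)
∑-toggle {n} i c c-flip f f-flip = begin
  2 * S                                              ≡⟨ cong (S +_) (+-identityʳ S) ⟩
  S + S                                              ≡⟨ cong (S +_) (∑-flip i (λ v → f (c v) v)) ⟩
  S + ∑[ v ← boolVecs n ] f (c (v [ i ]%= not)) (v [ i ]%= not)
    ≡⟨ cong (S +_) (∑-cong (boolVecs n) (λ v → trans (f-flip _ v) (cong (λ b → f b v) (c-flip v)))) ⟩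
  S + ∑[ v ← boolVecs n ] f (not (c v)) v            ≡⟨ ∑-+ (boolVecs n) _ _ ⟨
  ∑[ v ← boolVecs n ] (f (c v) v + f (not (c v)) v)  ≡⟨ ∑-cong (boolVecs n) (λ v → both (c v) v) ⟩
  ∑[ v ← boolVecs n ] (f true v + f false v)         ∎
  where
  open ≡-Reasoning
  S : ℕ
  S = ∑[ v ← boolVecs n ] f (c v) v
  both : ∀ b v → f b v + f (not b) v ≡ f true v + f false v
  both true  v = refl
  both false v = +-comm (f false v) (f true v)

-- v has pattern ε on columns j₁, j₂ when its ±1 entries there have product -1 exactly if ε.
hasPattern : Fin n → Fin n → Bool → Vec Bool n → Bool
hasPattern j₁ j₂ ε v = does (lookup v j₁ xor lookup v j₂ ≟ᵇ ε)

hasPattern-flipʳ : ∀ {j₁ j₂ : Fin n} ε v → j₁ ≢ j₂ →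
                   hasPattern j₁ j₂ ε (v [ j₂ ]%= not) ≡ not (hasPattern j₁ j₂ ε v)
hasPattern-flipʳ {j₁ = j₁} {j₂} ε v j₁≢j₂ = begin
  does (lookup (v [ j₂ ]%= not) j₁ xor lookup (v [ j₂ ]%= not) j₂ ≟ᵇ ε)
    ≡⟨ cong₂ (λ x y → does (x xor y ≟ᵇ ε)) (lookup∘updateAt′ j₁ j₂ j₁≢j₂ v) (lookup∘updateAt j₂ v) ⟩
  does (lookup v j₁ xor not (lookup v j₂) ≟ᵇ ε)
    ≡⟨ cong (λ x → does (x ≟ᵇ ε)) (not-distribʳ-xor (lookup v j₁) (lookup v j₂)) ⟨
  does (not (lookup v j₁ xor lookup v j₂) ≟ᵇ ε)
    ≡⟨ does-not-≟ (lookup v j₁ xor lookup v j₂) ε ⟩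
  not (does (lookup v j₁ xor lookup v j₂ ≟ᵇ ε)) ∎
  where
  open ≡-Reasoning
  does-not-≟ : ∀ x y → does (not x ≟ᵇ y) ≡ not (does (x ≟ᵇ y))
  does-not-≟ false false = refl
  does-not-≟ false true  = refl
  does-not-≟ true  false = refl
  does-not-≟ true  true  = refl

hasPattern-flip-other : ∀ {j₁ j₂ k : Fin n} ε v → j₁ ≢ k → j₂ ≢ k →
                        hasPattern j₁ j₂ ε (v [ k ]%= not) ≡ hasPattern j₁ j₂ ε v
hasPattern-flip-other {j₁ = j₁} {j₂} {k} ε v j₁≢k j₂≢k =
  cong₂ (λ x y → does (x xor y ≟ᵇ ε)) (lookup∘updateAt′ j₁ k j₁≢k v) (lookup∘updateAt′ j₂ k j₂≢k v)

weight : Bool → ℕ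
weight true  = 4
weight false = 1

∑-weight-pair : ∀ {j₁ j₂ : Fin n} ε → j₁ ≢ j₂ →
                2 * ∑[ v ← boolVecs n ] weight (hasPattern j₁ j₂ ε v) ≡ 5 * 2 ^ n
∑-weight-pair {n} {j₁} {j₂} ε j₁≢j₂ = begin
  2 * ∑[ v ← boolVecs n ] weight (hasPattern j₁ j₂ ε v)
    ≡⟨ ∑-toggle j₂ (hasPattern j₁ j₂ ε) (λ v → hasPattern-flipʳ ε v j₁≢j₂) (λ b _ → weight b) (λ _ _ → refl) ⟩
  ∑[ _ ← boolVecs n ] 5 ≡⟨ ∑-const (boolVecs n) 5 ⟩
  5 * length (boolVecs n) ≡⟨ cong (5 *_) (length-boolVecs n) ⟩
  5 * 2 ^ n ∎
  where open ≡-Reasoning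

∑-weight-triple : ∀ {j₁ j₂ j₃ : Fin n} ε₂ ε₃ → j₁ ≢ j₂ → j₁ ≢ j₃ → j₂ ≢ j₃ →
  4 * ∑[ v ← boolVecs n ] weight (hasPattern j₁ j₂ ε₂ v ∧ hasPattern j₁ j₃ ε₃ v) ≡ 7 * 2 ^ n
∑-weight-triple {n} {j₁} {j₂} {j₃} ε₂ ε₃ j₁≢j₂ j₁≢j₃ j₂≢j₃ = begin
  4 * ∑ (boolVecs n) W                                          ≡⟨ *-assoc 2 2 (∑ (boolVecs n) W) ⟩
  2 * (2 * ∑ (boolVecs n) W)
    ≡⟨ cong (2 *_) (∑-toggle j₂ (hasPattern j₁ j₂ ε₂) (λ v → hasPattern-flipʳ ε₂ v j₁≢j₂)
         (λ b v → weight (b ∧ hasPattern j₁ j₃ ε₃ v))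
         (λ b v → cong (λ c → weight (b ∧ c)) (hasPattern-flip-other ε₃ v j₁≢j₂ (j₂≢j₃ ∘ sym)))) ⟩
  2 * ∑[ v ← boolVecs n ] (weight (hasPattern j₁ j₃ ε₃ v) + 1)
    ≡⟨ ∑-toggle j₃ (hasPattern j₁ j₃ ε₃) (λ v → hasPattern-flipʳ ε₃ v j₁≢j₃) (λ b _ → weight b + 1) (λ _ _ → refl) ⟩
  ∑[ _ ← boolVecs n ] 7 ≡⟨ ∑-const (boolVecs n) 7 ⟩
  7 * length (boolVecs n) ≡⟨ cong (7 *_) (length-boolVecs n) ⟩
  7 * 2 ^ n ∎
  where
  open ≡-Reasoning
  W : Vec Bool n → ℕ
  W v = weight (hasPattern j₁ j₂ ε₂ v ∧ hasPattern j₁ j₃ ε₃ v)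

Distinct₂ : Fin n × Fin n → Set
Distinct₂ (j₁ , j₂) = j₁ ≢ j₂

Distinct₃ : Fin n × Fin n × Fin n → Set
Distinct₃ (j₁ , j₂ , j₃) = j₁ ≢ j₂ × j₁ ≢ j₃ × j₂ ≢ j₃

distinct₂? : (p : Fin n × Fin n) → Dec (Distinct₂ p)
distinct₂? (j₁ , j₂) = ¬? (j₁ ≟ᶠ j₂)

distinct₃? : (p : Fin n × Fin n × Fin n) → Dec (Distinct₃ p)
distinct₃? (j₁ , j₂ , j₃) = ¬? (j₁ ≟ᶠ j₂) ×-dec ¬? (j₁ ≟ᶠ j₃) ×-dec ¬? (j₂ ≟ᶠ j₃)

allPairs : ∀ n → List (Fin n × Fin n)
allPairs n = cartesianProduct (allFin n) (allFin n)

allTriples : ∀ n → List (Fin n × Fin n × Fin n)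
allTriples n = cartesianProduct (allFin n) (allPairs n)

distinctPairs : ∀ n → List (Fin n × Fin n)
distinctPairs n = filter distinct₂? (allPairs n)

distinctTriples : ∀ n → List (Fin n × Fin n × Fin n)
distinctTriples n = filter distinct₃? (allTriples n)

∈-distinctPairs⁺ : ∀ {j₁ j₂ : Fin n} → j₁ ≢ j₂ → (j₁ , j₂) ∈ distinctPairs n
∈-distinctPairs⁺ {j₁ = j₁} {j₂} = ∈-filter⁺ distinct₂? (∈-cartesianProduct⁺ (∈-allFin j₁) (∈-allFin j₂))

∈-distinctPairs⁻ : ∀ {p : Fin n × Fin n} → p ∈ distinctPairs n → Distinct₂ p
∈-distinctPairs⁻ {n} = proj₂ ∘ ∈-filter⁻ distinct₂? {xs = allPairs n}

∈-distinctTriples⁺ : ∀ {p : Fin n × Fin n × Fin n} → Distinct₃ p → p ∈ distinctTriples n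
∈-distinctTriples⁺ {p = j₁ , j₂ , j₃} =
  ∈-filter⁺ distinct₃? (∈-cartesianProduct⁺ (∈-allFin j₁) (∈-cartesianProduct⁺ (∈-allFin j₂) (∈-allFin j₃)))

∈-distinctTriples⁻ : ∀ {p : Fin n × Fin n × Fin n} → p ∈ distinctTriples n → Distinct₃ p
∈-distinctTriples⁻ {n} = proj₂ ∘ ∈-filter⁻ distinct₃? {xs = allTriples n}

pairTests : ∀ n → List ((Fin n × Fin n) × Bool)
pairTests n = cartesianProduct (distinctPairs n) bools

tripleTests : ∀ n → List ((Fin n × Fin n × Fin n) × Bool × Bool)
tripleTests n = cartesianProduct (distinctTriples n) (cartesianProduct bools bools)

pairHit : (Fin n × Fin n) × Bool → Vec Bool n → Bool
pairHit ((j₁ , j₂) , ε) = hasPattern j₁ j₂ ε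

tripleHit : (Fin n × Fin n × Fin n) × Bool × Bool → Vec Bool n → Bool
tripleHit ((j₁ , j₂ , j₃) , ε₂ , ε₃) v = hasPattern j₁ j₂ ε₂ v ∧ hasPattern j₁ j₃ ε₃ v

length-allFin : ∀ n → length (allFin n) ≡ n
length-allFin n = length-tabulate (λ (i : Fin n) → i)

length-allPairs : ∀ n → length (allPairs n) ≡ n * n
length-allPairs n = trans (length-cartesianProductWith _,_ (allFin n) (allFin n))
                          (cong₂ _*_ (length-allFin n) (length-allFin n))

length-pairTests : ∀ n → length (pairTests n) ≤ n * n * 2
length-pairTests n = begin
  length (pairTests n)                                ≡⟨ length-cartesianProductWith _,_ (distinctPairs n) bools ⟩
  length (distinctPairs n) * 2                        ≤⟨ *-monoˡ-≤ 2 (length-filter distinct₂? (allPairs n)) ⟩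
  length (allPairs n) * 2                             ≡⟨ cong (_* 2) (length-allPairs n) ⟩
  n * n * 2                                           ∎
  where open ≤-Reasoning

length-tripleTests : ∀ n → length (tripleTests n) ≤ n * n * n * 4
length-tripleTests n = begin
  length (tripleTests n)
    ≡⟨ length-cartesianProductWith _,_ (distinctTriples n) (cartesianProduct bools bools) ⟩
  length (distinctTriples n) * 4
    ≤⟨ *-monoˡ-≤ 4 (length-filter distinct₃? (allTriples n)) ⟩
  length (allTriples n) * 4
    ≡⟨ cong (_* 4) (length-cartesianProductWith _,_ (allFin n) (allPairs n)) ⟩
  length (allFin n) * length (allPairs n) * 4
    ≡⟨ cong₂ (λ a b → a * b * 4) (length-allFin n) (length-allPairs n) ⟩
  n * (n * n) * 4
    ≡⟨ cong (_* 4) (*-assoc n n n) ⟨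
  n * n * n * 4 ∎
  where open ≤-Reasoning

∑-weight-pairTests : ∀ n → All (λ t → 2 * ∑[ v ← boolVecs n ] weight (pairHit t v) ≡ 5 * 2 ^ n) (pairTests n)
∑-weight-pairTests n = All.tabulate λ {(_ , ε)} t∈ →
  ∑-weight-pair ε (∈-distinctPairs⁻ (proj₁ (∈-cartesianProduct⁻ (distinctPairs n) bools t∈)))

∑-weight-tripleTests : ∀ n →
  All (λ t → 4 * ∑[ v ← boolVecs n ] weight (tripleHit t v) ≡ 7 * 2 ^ n) (tripleTests n)
∑-weight-tripleTests n = All.tabulate λ {(_ , ε₂ , ε₃)} t∈ →
  let (j₁≢j₂ , j₁≢j₃ , j₂≢j₃) =
        ∈-distinctTriples⁻ (proj₁ (∈-cartesianProduct⁻ (distinctTriples n) (cartesianProduct bools bools) t∈))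
  in ∑-weight-triple ε₂ ε₃ j₁≢j₂ j₁≢j₃ j₂≢j₃

score : (T → Vec Bool n → Bool) → List T → Vec (Vec Bool n) m → ℕ
score hit ts X = ∑[ t ← ts ] ∏ (weight ∘ hit t) X

potential : SignMatrix m → ℕ
potential {m} X = 4 * score pairHit (pairTests m) X + 2 ^ m * score tripleHit (tripleTests m) X

symmetricPotential : SignMatrix m → ℕ
symmetricPotential X = potential X + potential (transpose X)

-- The average potential

^-distribʳ-* : ∀ a b n → (a * b) ^ n ≡ a ^ n * b ^ n
^-distribʳ-* a b zero    = refl
^-distribʳ-* a b (suc n) = trans (cong (a * b *_) (^-distribʳ-* a b n)) (*-*-exch a b (a ^ n) (b ^ n))
  where
  *-*-exch : ∀ a b c d → a * b * (c * d) ≡ a * c * (b * d)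
  *-*-exch = solve-∀

∑-score : ∀ (hit : T → Vec Bool n → Bool) (ts : List T) m →
  ∑[ X ← signMatrices m n ] score hit ts X ≡ ∑[ t ← ts ] ((∑[ v ← boolVecs n ] weight (hit t v)) ^ m)
∑-score {n = n} hit ts m = trans (∑-swap (signMatrices m n) ts _)
                                  (∑-cong ts (λ t → ∑-∏ (boolVecs n) (weight ∘ hit t) m))

∑-score-uniform : ∀ (hit : T → Vec Bool n → Bool) (ts : List T) m {c d} →
  All (λ t → c * ∑[ v ← boolVecs n ] weight (hit t v) ≡ d * 2 ^ n) ts →
  c ^ m * ∑[ X ← signMatrices m n ] score hit ts X ≡ length ts * (d ^ m * 2 ^ (n * m))
∑-score-uniform {T = T} {n = n} hit ts m {c} {d} uniform = begin
  c ^ m * ∑[ X ← signMatrices m n ] score hit ts X ≡⟨ cong (c ^ m *_) (∑-score hit ts m) ⟩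
  c ^ m * ∑[ t ← ts ] (average t ^ m)             ≡⟨ ∑-*ˡ ts (c ^ m) (λ t → average t ^ m) ⟨
  ∑[ t ← ts ] (c ^ m * average t ^ m)             ≡⟨ ∑-cong ts (λ t → ^-distribʳ-* c (average t) m) ⟨
  ∑[ t ← ts ] ((c * average t) ^ m)               ≡⟨ ∑-cong-All (All.map (cong (_^ m)) uniform) ⟩
  ∑[ _ ← ts ] ((d * 2 ^ n) ^ m)                   ≡⟨ ∑-const ts _ ⟩
  (d * 2 ^ n) ^ m * length ts                     ≡⟨ *-comm ((d * 2 ^ n) ^ m) (length ts) ⟩
  length ts * (d * 2 ^ n) ^ m                     ≡⟨ cong (length ts *_) (^-distribʳ-* d (2 ^ n) m) ⟩
  length ts * (d ^ m * (2 ^ n) ^ m)               ≡⟨ cong (λ e → length ts * (d ^ m * e)) (^-*-assoc 2 n m) ⟩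
  length ts * (d ^ m * 2 ^ (n * m))               ∎
  where
  open ≡-Reasoning
  average : T → ℕ
  average t = ∑[ v ← boolVecs n ] weight (hit t v)

m*m≤m*m*m : ∀ m → m * m ≤ m * m * m
m*m≤m*m*m zero    = z≤n
m*m≤m*m*m (suc m) = m≤m*n (suc m * suc m) (suc m)

∑-potential : ∀ m → 2 ^ m * ∑[ X ← signMatrices m m ] potential X ≤ 12 * (m * m * m) * 7 ^ m * 2 ^ (m * m)
∑-potential m = begin
  2 ^ m * ∑[ X ← signMatrices m m ] potential X
    ≡⟨ cong (2 ^ m *_) ∑-potential-split ⟩
  2 ^ m * (4 * P + 2 ^ m * Q)
    ≡⟨ distribute (2 ^ m) P Q ⟩
  4 * (2 ^ m * P) + 2 ^ m * 2 ^ m * Q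
    ≡⟨ cong (λ e → 4 * (2 ^ m * P) + e * Q) (^-distribʳ-* 2 2 m) ⟨
  4 * (2 ^ m * P) + 4 ^ m * Q
    ≡⟨ cong₂ (λ p q → 4 * p + q) (∑-score-uniform pairHit (pairTests m) m (∑-weight-pairTests m))
                                 (∑-score-uniform tripleHit (tripleTests m) m (∑-weight-tripleTests m)) ⟩
  4 * (length (pairTests m) * (5 ^ m * N)) + length (tripleTests m) * (7 ^ m * N)
    ≤⟨ +-mono-≤ (*-monoʳ-≤ 4 (*-monoˡ-≤ (5 ^ m * N) (length-pairTests m)))
                (*-monoˡ-≤ (7 ^ m * N) (length-tripleTests m)) ⟩
  4 * (m * m * 2 * (5 ^ m * N)) + m * m * m * 4 * (7 ^ m * N)
    ≡⟨ collect (m * m) (m * m * m) (5 ^ m) (7 ^ m) N ⟩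
  8 * (m * m * 5 ^ m) * N + 4 * (m * m * m * 7 ^ m) * N
    ≤⟨ +-monoˡ-≤ (4 * (m * m * m * 7 ^ m) * N)
         (*-monoˡ-≤ N (*-monoʳ-≤ 8 (*-mono-≤ (m*m≤m*m*m m) (^-monoˡ-≤ m (s≤s (s≤s (s≤s (s≤s (s≤s z≤n))))))))) ⟩
  8 * (m * m * m * 7 ^ m) * N + 4 * (m * m * m * 7 ^ m) * N
    ≡⟨ add (m * m * m) (7 ^ m) N ⟩
  12 * (m * m * m) * 7 ^ m * N ∎
  where
  open ≤-Reasoning
  N P Q : ℕ
  N = 2 ^ (m * m)
  P = ∑[ X ← signMatrices m m ] score pairHit (pairTests m) X
  Q = ∑[ X ← signMatrices m m ] score tripleHit (tripleTests m) X
  ∑-potential-split : ∑[ X ← signMatrices m m ] potential X ≡ 4 * P + 2 ^ m * Q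
  ∑-potential-split = trans (∑-+ (signMatrices m m) _ _)
                            (cong₂ _+_ (∑-*ˡ (signMatrices m m) 4 _) (∑-*ˡ (signMatrices m m) (2 ^ m) _))
  distribute : ∀ a p q → a * (4 * p + a * q) ≡ 4 * (a * p) + a * a * q
  distribute = solve-∀
  collect : ∀ m² m³ f s n → 4 * (m² * 2 * (f * n)) + m³ * 4 * (s * n) ≡ 8 * (m² * f) * n + 4 * (m³ * s) * n
  collect = solve-∀
  add : ∀ m³ s n → 8 * (m³ * s) * n + 4 * (m³ * s) * n ≡ 12 * m³ * s * n
  add = solve-∀

-- A rank-one submatrix forces a large potential

avoid-zero : ∀ (ρ : Fin r → Fin (suc m)) → Injective _≡_ _≡_ ρ → (∀ a → ρ a ≢ zero) →
             Σ (Fin r → Fin m) λ τ → Injective _≡_ _≡_ τ × (∀ a → ρ a ≡ suc (τ a))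
avoid-zero {r} {m} ρ ρ-inj ρ≢0 = τ , τ-inj , ρ≡sucτ
  where
  τ : Fin r → Fin m
  τ a = punchOut (ρ≢0 a ∘ sym)
  ρ≡sucτ : ∀ a → ρ a ≡ suc (τ a)
  ρ≡sucτ a = sym (punchIn-punchOut (ρ≢0 a ∘ sym))
  τ-inj : Injective _≡_ _≡_ τ
  τ-inj {a} {b} τa≡τb = ρ-inj (trans (ρ≡sucτ a) (trans (cong suc τa≡τb) (sym (ρ≡sucτ b))))

1≤∏ : ∀ {g : A → ℕ} → (∀ x → 1 ≤ g x) → (X : Vec A m) → 1 ≤ ∏ g X
1≤∏ g≥1 []      = ≤-refl
1≤∏ g≥1 (x ∷ X) = *-mono-≤ (g≥1 x) (1≤∏ g≥1 X)

pow≤∏ : ∀ {g : A → ℕ} {c} → (∀ x → 1 ≤ g x) → (X : Vec A m) (ρ : Fin r → Fin m) →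
        Injective _≡_ _≡_ ρ → (∀ a → c ≤ g (lookup X (ρ a))) → c ^ r ≤ ∏ g X
pow≤∏ {r = zero}  g≥1 X       _ _     _  = 1≤∏ g≥1 X
pow≤∏ {r = suc r} g≥1 []      ρ _     _  with () ← ρ zero
pow≤∏ {m = suc m} {r = suc r} {g = g} {c} g≥1 (x ∷ X) ρ ρ-inj c≤ with any? (λ a → ρ a ≟ᶠ zero)
... | no ρ≢0 =
  let (τ , τ-inj , ρ≡sucτ) = avoid-zero ρ ρ-inj (λ a ρa≡0 → ρ≢0 (a , ρa≡0)) in begin
    c ^ suc r    ≤⟨ pow≤∏ g≥1 X τ τ-inj (λ a → subst c≤g[x∷X] (ρ≡sucτ a) (c≤ a)) ⟩
    ∏ g X        ≤⟨ m≤n*m (∏ g X) (g x) {{>-nonZero (g≥1 x)}} ⟩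
    g x * ∏ g X  ∎
  where
  open ≤-Reasoning
  c≤g[x∷X] : Fin (suc m) → Set
  c≤g[x∷X] i = c ≤ g (lookup (x ∷ X) i)
... | yes (a₀ , ρa₀≡0) =
  let (τ , τ-inj , ρ≡sucτ) = avoid-zero (ρ ∘ punchIn a₀) (punchIn-injective a₀ _ _ ∘ ρ-inj)
                               (λ b ρb≡0 → punchInᵢ≢i a₀ b (ρ-inj (trans ρb≡0 (sym ρa₀≡0)))) in
  *-mono-≤ (subst c≤g[x∷X] ρa₀≡0 (c≤ a₀))
           (pow≤∏ g≥1 X τ τ-inj (λ b → subst c≤g[x∷X] (ρ≡sucτ b) (c≤ (punchIn a₀ b))))
  where
  c≤g[x∷X] : Fin (suc m) → Set
  c≤g[x∷X] i = c ≤ g (lookup (x ∷ X) i)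

4^r≤score : ∀ (hit : T → Vec Bool n → Bool) {ts t} (X : Vec (Vec Bool n) m) (ρ : Fin r → Fin m) →
            t ∈ ts → Injective _≡_ _≡_ ρ → (∀ a → hit t (lookup X (ρ a)) ≡ true) → 4 ^ r ≤ score hit ts X
4^r≤score hit {t = t} X ρ t∈ts ρ-inj hits =
  ≤-trans (pow≤∏ (weight≥1 ∘ hit t) X ρ ρ-inj (λ a → ≤-reflexive (cong weight (sym (hits a)))))
          (∈⇒≤∑ (λ t → ∏ (weight ∘ hit t) X) t∈ts)
  where
  weight≥1 : ∀ b → 1 ≤ weight b
  weight≥1 true  = s≤s z≤n
  weight≥1 false = s≤s z≤n

submatrix : Vec (Vec A n) m → (Fin r → Fin m) → (Fin s → Fin n) → Fin r → Fin s → A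
submatrix X ρ σ i j = lookup (lookup X (ρ i)) (σ j)

-- Rows a, b of a ±1 matrix are proportional iff Y a c · Y a d = Y b c · Y b d for all columns c, d;
-- with signs encoded as booleans that product is an exclusive or.
ProportionalRows : (Fin r → Fin s → Bool) → Set
ProportionalRows x = ∀ a b c d → x a c xor x a d ≡ x b c xor x b d

val-*-val : ∀ p q → val p *ℚ val q ≡ val (not (p xor q))
val-*-val true  true  = refl
val-*-val true  false = refl
val-*-val false true  = refl
val-*-val false false = refl

val² : ∀ p → val p *ℚ val p ≡ 1ℚ
val² p = trans (val-*-val p p) (cong (val ∘ not) (xor-same p))

val-injective : ∀ {p q} → val p ≡ val q → p ≡ q
val-injective {true}  {true}  _ = refl
val-injective {true}  {false} ()
val-injective {false} {true}  ()
val-injective {false} {false} _ = refl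

outerProduct⇒proportionalRows : ∀ (x : Fin r → Fin s → Bool) (u : Fin r → ℚ) (v : Fin s → ℚ) →
                                (∀ i j → val (x i j) ≡ u i *ℚ v j) → ProportionalRows x
outerProduct⇒proportionalRows {r} {s} x u v y≡uv a b c d =
  not-injective (val-injective (begin
    val (not (x a c xor x a d))             ≡⟨ val-*-val (x a c) (x a d) ⟨
    y a c *ℚ y a d                          ≡⟨ *ℚ-identityʳ _ ⟨
    (y a c *ℚ y a d) *ℚ 1ℚ                  ≡⟨ cong ((y a c *ℚ y a d) *ℚ_) (val² (x b c)) ⟨
    (y a c *ℚ y a d) *ℚ (y b c *ℚ y b c)
      ≡⟨ cong₂ _*ℚ_ (cong₂ _*ℚ_ (y≡uv a c) (y≡uv a d)) (cong₂ _*ℚ_ (y≡uv b c) (y≡uv b c)) ⟩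
    ((u a *ℚ v c) *ℚ (u a *ℚ v d)) *ℚ ((u b *ℚ v c) *ℚ (u b *ℚ v c))
      ≡⟨ exchange (u a) (u b) (v c) (v d) ⟩
    ((u b *ℚ v c) *ℚ (u b *ℚ v d)) *ℚ ((u a *ℚ v c) *ℚ (u a *ℚ v c))
      ≡⟨ cong₂ _*ℚ_ (cong₂ _*ℚ_ (y≡uv b c) (y≡uv b d)) (cong₂ _*ℚ_ (y≡uv a c) (y≡uv a c)) ⟨
    (y b c *ℚ y b d) *ℚ (y a c *ℚ y a c)    ≡⟨ cong ((y b c *ℚ y b d) *ℚ_) (val² (x a c)) ⟩
    (y b c *ℚ y b d) *ℚ 1ℚ                  ≡⟨ *ℚ-identityʳ _ ⟩
    y b c *ℚ y b d                          ≡⟨ val-*-val (x b c) (x b d) ⟩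
    val (not (x b c xor x b d))             ∎))
  where
  open ≡-Reasoning
  y : Fin r → Fin s → ℚ
  y i j = val (x i j)
  exchange : ∀ p q r t → ((p *ℚ r) *ℚ (p *ℚ t)) *ℚ ((q *ℚ r) *ℚ (q *ℚ r)) ≡
                         ((q *ℚ r) *ℚ (q *ℚ t)) *ℚ ((p *ℚ r) *ℚ (p *ℚ r))
  exchange = solve 4 (λ p q r t → ((p :* r) :* (p :* t)) :* ((q :* r) :* (q :* r)) :=
                                  ((q :* r) :* (q :* t)) :* ((p :* r) :* (p :* r))) refl
    where open import Data.Rational.Solver using (module +-*-Solver)
          open +-*-Solver

module _ (X : Vec (Vec Bool n) m) (ρ : Fin r → Fin m) (σ : Fin s → Fin n)
         (ρ-inj : Injective _≡_ _≡_ ρ) (σ-inj : Injective _≡_ _≡_ σ)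
         (rows : ProportionalRows (submatrix X ρ σ)) (a₀ : Fin r) where

  private
    x : Fin r → Fin s → Bool
    x = submatrix X ρ σ

    pattern-of-a₀ : ∀ a c d → hasPattern (σ c) (σ d) (x a₀ c xor x a₀ d) (lookup X (ρ a)) ≡ true
    pattern-of-a₀ a c d = dec-true (x a c xor x a d ≟ᵇ x a₀ c xor x a₀ d) (rows a a₀ c d)

  4^r≤pairScore : ∀ {c d} → c ≢ d → 4 ^ r ≤ score pairHit (pairTests n) X
  4^r≤pairScore {c} {d} c≢d = 4^r≤score pairHit X ρ t∈tests ρ-inj (λ a → pattern-of-a₀ a c d)
    where
    t∈tests : ((σ c , σ d) , x a₀ c xor x a₀ d) ∈ pairTests n
    t∈tests = ∈-cartesianProduct⁺ (∈-distinctPairs⁺ (c≢d ∘ σ-inj)) (∈-bools _)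

  4^r≤tripleScore : ∀ {c d e} → c ≢ d → c ≢ e → d ≢ e → 4 ^ r ≤ score tripleHit (tripleTests n) X
  4^r≤tripleScore {c} {d} {e} c≢d c≢e d≢e =
    4^r≤score tripleHit X ρ t∈tests ρ-inj (λ a → cong₂ _∧_ (pattern-of-a₀ a c d) (pattern-of-a₀ a c e))
    where
    t∈tests : ((σ c , σ d , σ e) , x a₀ c xor x a₀ d , x a₀ c xor x a₀ e) ∈ tripleTests n
    t∈tests = ∈-cartesianProduct⁺ (∈-distinctTriples⁺ (c≢d ∘ σ-inj , c≢e ∘ σ-inj , d≢e ∘ σ-inj))
                                  (∈-cartesianProduct⁺ (∈-bools _) (∈-bools _))

4^[1+m]≤2^m*4^r : ∀ m r → m + 2 ≤ r + r → 4 ^ suc m ≤ 2 ^ m * 4 ^ r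
4^[1+m]≤2^m*4^r m r m+2≤r+r = begin
  4 ^ suc m                  ≡⟨ ^-distribʳ-* 2 2 (suc m) ⟩
  2 ^ suc m * 2 ^ suc m      ≡⟨ ^-distribˡ-+-* 2 (suc m) (suc m) ⟨
  2 ^ (suc m + suc m)        ≡⟨ cong (2 ^_) (exponent m) ⟩
  2 ^ (m + (m + 2))          ≤⟨ ^-monoʳ-≤ 2 (+-monoʳ-≤ m m+2≤r+r) ⟩
  2 ^ (m + (r + r))          ≡⟨ ^-distribˡ-+-* 2 m (r + r) ⟩
  2 ^ m * 2 ^ (r + r)        ≡⟨ cong (2 ^ m *_) (^-distribˡ-+-* 2 r r) ⟩
  2 ^ m * (2 ^ r * 2 ^ r)    ≡⟨ cong (2 ^ m *_) (^-distribʳ-* 2 2 r) ⟨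
  2 ^ m * 4 ^ r              ∎
  where
  open ≤-Reasoning
  exponent : ∀ m → suc m + suc m ≡ m + (m + 2)
  exponent = solve-∀

proportionalRows⇒4^[1+m]≤potential :
  ∀ (X : SignMatrix m) (ρ : Fin r → Fin m) (σ : Fin s → Fin m) →
  Injective _≡_ _≡_ ρ → Injective _≡_ _≡_ σ → r + s ≡ m + 2 → 2 ≤ s → s ≤ r →
  ProportionalRows (submatrix X ρ σ) → 4 ^ suc m ≤ potential X
proportionalRows⇒4^[1+m]≤potential {m} {r} {2} X ρ σ ρ-inj σ-inj r+2≡m+2 (s≤s (s≤s _)) (s≤s (s≤s _)) rows = begin
  4 * 4 ^ m                                ≡⟨ cong (λ k → 4 * 4 ^ k) (+-cancelʳ-≡ 2 r m r+2≡m+2) ⟨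
  4 * 4 ^ r                                ≤⟨ *-monoʳ-≤ 4 (4^r≤pairScore X ρ σ ρ-inj σ-inj rows zero {zero} {suc zero} λ ()) ⟩
  4 * score pairHit (pairTests m) X        ≤⟨ m≤m+n _ _ ⟩
  potential X                              ∎
  where open ≤-Reasoning
proportionalRows⇒4^[1+m]≤potential {m} {r} {suc (suc (suc s))} X ρ σ ρ-inj σ-inj r+s≡m+2 (s≤s (s≤s _)) s≤r@(s≤s (s≤s _)) rows = begin
  4 ^ suc m                                ≤⟨ 4^[1+m]≤2^m*4^r m r m+2≤r+r ⟩
  2 ^ m * 4 ^ r
    ≤⟨ *-monoʳ-≤ (2 ^ m) (4^r≤tripleScore X ρ σ ρ-inj σ-inj rows zero {zero} {suc zero} {suc (suc zero)} (λ ()) (λ ()) (λ ())) ⟩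
  2 ^ m * score tripleHit (tripleTests m) X ≤⟨ m≤n+m _ _ ⟩
  potential X                              ∎
  where
  open ≤-Reasoning
  m+2≤r+r : m + 2 ≤ r + r
  m+2≤r+r = subst (_≤ r + r) r+s≡m+2 (+-monoʳ-≤ r s≤r)

strictlyIncreasing⇒injective : ∀ {f : Fin r → Fin m} → StrictlyIncreasing f → Injective _≡_ _≡_ f
strictlyIncreasing⇒injective {f = f} f↑ {a} {b} fa≡fb with <ᶠ-cmp a b
... | tri< a<b _ _ = contradiction fa≡fb (<ᶠ⇒≢ (f↑ a b a<b))
... | tri≈ _ a≡b _ = a≡b
... | tri> _ _ b<a = contradiction (sym fa≡fb) (<ᶠ⇒≢ (f↑ b a b<a))

r+s≡m+2⇒2≤s : r ≤ m → r + s ≡ m + 2 → 2 ≤ s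
r+s≡m+2⇒2≤s {r} {m} {s} r≤m r+s≡m+2 = +-cancelˡ-≤ m 2 s (subst (_≤ m + s) r+s≡m+2 (+-monoˡ-≤ s r≤m))

outerProduct⇒4^[1+m]≤symmetricPotential :
  ∀ (X : SignMatrix m) (ρ : Fin r → Fin m) (σ : Fin s → Fin m) →
  Injective _≡_ _≡_ ρ → Injective _≡_ _≡_ σ → r + s ≡ m + 2 → (u : Fin r → ℚ) (v : Fin s → ℚ) →
  (∀ i j → entry X (ρ i) (σ j) ≡ u i *ℚ v j) → 4 ^ suc m ≤ symmetricPotential X
outerProduct⇒4^[1+m]≤symmetricPotential {m = m} {r = r} {s} X ρ σ ρ-inj σ-inj r+s≡m+2 u v Y≡uv with s ≤? r
... | yes s≤r = ≤-trans
  (proportionalRows⇒4^[1+m]≤potential X ρ σ ρ-inj σ-inj r+s≡m+2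
    (r+s≡m+2⇒2≤s (injective⇒≤ ρ-inj) r+s≡m+2) s≤r
    (outerProduct⇒proportionalRows (submatrix X ρ σ) u v Y≡uv))
  (m≤m+n (potential X) (potential (transpose X)))
... | no s≰r = ≤-trans
  (proportionalRows⇒4^[1+m]≤potential (transpose X) σ ρ σ-inj ρ-inj s+r≡m+2
    (r+s≡m+2⇒2≤s (injective⇒≤ σ-inj) s+r≡m+2) (<⇒≤ (≰⇒> s≰r))
    (outerProduct⇒proportionalRows (submatrix (transpose X) σ ρ) v u
      λ j i → trans (cong val (lookup-transpose X (ρ i) (σ j))) (trans (Y≡uv i j) (*ℚ-comm (u i) (v j)))))
  (m≤n+m (potential (transpose X)) (potential X))
  where
  s+r≡m+2 : s + r ≡ m + 2
  s+r≡m+2 = trans (+-comm s r) r+s≡m+2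

badSubmatrix⇒4^[1+m]≤symmetricPotential : ∀ (X : SignMatrix m) → ContainsBadSubmatrix m X → 4 ^ suc m ≤ symmetricPotential X
badSubmatrix⇒4^[1+m]≤symmetricPotential X (_ , _ , r+s≡m+2 , ρ , σ , ρ↑ , σ↑ , _ , u , v , Y≡uv) =
  outerProduct⇒4^[1+m]≤symmetricPotential X ρ σ (strictlyIncreasing⇒injective ρ↑) (strictlyIncreasing⇒injective σ↑)
    r+s≡m+2 u v Y≡uv

markov : ∀ (g : A → ℕ) t (t≤g? : ∀ x → Dec (t ≤ g x)) xs → t * length (filter t≤g? xs) ≤ ∑ xs g
markov g t t≤g? []       = ≤-reflexive (*-zeroʳ t)
markov g t t≤g? (x ∷ xs) with t≤g? x
... | yes t≤gx = begin
  t * suc (length (filter t≤g? xs))  ≡⟨ *-suc t _ ⟩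
  t + t * length (filter t≤g? xs)    ≤⟨ +-mono-≤ t≤gx (markov g t t≤g? xs) ⟩
  g x + ∑ xs g                       ∎
  where open ≤-Reasoning
... | no _ = ≤-trans (markov g t t≤g? xs) (m≤n+m _ (g x))

length-filter-∁ : ∀ {P : A → Set} (P? : U.Decidable P) xs →
                  length (filter (∁? P?) xs) + length (filter P? xs) ≡ length xs
length-filter-∁ P? []       = refl
length-filter-∁ P? (x ∷ xs) with P? x
... | yes _ = trans (+-suc _ _) (cong suc (length-filter-∁ P? xs))
... | no  _ = cong suc (length-filter-∁ P? xs)

highPotentialCount : ℕ → ℕ
highPotentialCount m = length (filter (λ X → 4 ^ suc m ≤? symmetricPotential X) (signMatrices m m))

8^m*highPotentialCount≤ : ∀ m → 8 ^ m * highPotentialCount m ≤ 6 * (m * m * m) * 7 ^ m * 2 ^ (m * m)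
8^m*highPotentialCount≤ m = *-cancelˡ-≤ 4 (begin
  4 * (8 ^ m * #high)                           ≡⟨ cong (λ e → 4 * (e * #high)) (^-distribʳ-* 2 4 m) ⟩
  4 * (2 ^ m * 4 ^ m * #high)                   ≡⟨ regroup (2 ^ m) (4 ^ m) #high ⟩
  2 ^ m * (4 ^ suc m * #high)                   ≤⟨ *-monoʳ-≤ (2 ^ m) (markov symmetricPotential (4 ^ suc m) _ Xs) ⟩
  2 ^ m * ∑ Xs symmetricPotential               ≡⟨ cong (2 ^ m *_) ∑-symmetricPotential ⟩
  2 ^ m * (2 * ∑ Xs potential)                  ≡⟨ *-left-comm (2 ^ m) 2 (∑ Xs potential) ⟩
  2 * (2 ^ m * ∑ Xs potential)                  ≤⟨ *-monoʳ-≤ 2 (∑-potential m) ⟩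
  2 * (12 * (m * m * m) * 7 ^ m * 2 ^ (m * m))  ≡⟨ halve (m * m * m) (7 ^ m) (2 ^ (m * m)) ⟩
  4 * (6 * (m * m * m) * 7 ^ m * 2 ^ (m * m))   ∎)
  where
  open ≤-Reasoning
  Xs : List (SignMatrix m)
  Xs = signMatrices m m
  #high : ℕ
  #high = highPotentialCount m
  ∑-symmetricPotential : ∑ Xs symmetricPotential ≡ 2 * ∑ Xs potential
  ∑-symmetricPotential = begin-equality
    ∑ Xs symmetricPotential                        ≡⟨ ∑-+ Xs potential (potential ∘ transpose) ⟩
    ∑ Xs potential + ∑ Xs (potential ∘ transpose) ≡⟨ cong (∑ Xs potential +_) (∑-transpose bools m m potential) ⟨
    ∑ Xs potential + ∑ Xs potential                ≡⟨ cong (∑ Xs potential +_) (+-identityʳ _) ⟨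
    2 * ∑ Xs potential                             ∎
  regroup : ∀ a b c → 4 * (a * b * c) ≡ a * (4 * b * c)
  regroup = solve-∀
  halve : ∀ x y z → 2 * (12 * x * y * z) ≡ 4 * (6 * x * y * z)
  halve = solve-∀

-- 30 is the least shift for which 7 (31 + n)⁴ ≤ 8 (30 + n)⁴ holds already at n = 0; the
-- difference is a polynomial in n with nonnegative coefficients.
7*[31+n]⁴≤8*[30+n]⁴ : ∀ n → 7 * (31 + n) ^ 4 ≤ 8 * (30 + n) ^ 4
7*[31+n]⁴≤8*[30+n]⁴ n = subst (7 * (31 + n) ^ 4 ≤_) (sym (expand n)) (m≤m+n _ _)
  where
  expand : ∀ n → 8 * ((30 + n) * ((30 + n) * ((30 + n) * ((30 + n) * 1)))) ≡
                 7 * ((31 + n) * ((31 + n) * ((31 + n) * ((31 + n) * 1)))) +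
                 (n * n * n * n + 92 * (n * n * n) + 2838 * (n * n) + 29852 * n + 15353)
  expand = solve-∀

7^n*[30+n]⁴≤30⁴*8^n : ∀ n → 7 ^ n * (30 + n) ^ 4 ≤ 30 ^ 4 * 8 ^ n
7^n*[30+n]⁴≤30⁴*8^n zero    = ≤-refl
7^n*[30+n]⁴≤30⁴*8^n (suc n) = begin
  7 * 7 ^ n * (31 + n) ^ 4      ≡⟨ *-assoc 7 (7 ^ n) ((31 + n) ^ 4) ⟩
  7 * (7 ^ n * (31 + n) ^ 4)    ≡⟨ *-left-comm 7 (7 ^ n) ((31 + n) ^ 4) ⟩
  7 ^ n * (7 * (31 + n) ^ 4)    ≤⟨ *-monoʳ-≤ (7 ^ n) (7*[31+n]⁴≤8*[30+n]⁴ n) ⟩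
  7 ^ n * (8 * (30 + n) ^ 4)    ≡⟨ *-left-comm 8 (7 ^ n) ((30 + n) ^ 4) ⟨
  8 * (7 ^ n * (30 + n) ^ 4)    ≤⟨ *-monoʳ-≤ 8 (7^n*[30+n]⁴≤30⁴*8^n n) ⟩
  8 * (30 ^ 4 * 8 ^ n)          ≡⟨ *-left-comm 8 (30 ^ 4) (8 ^ n) ⟩
  30 ^ 4 * (8 * 8 ^ n)          ∎
  where open ≤-Reasoning

c*n³*7^n≤8^n-eventually : ∀ c → ∃[ M ] ∀ n → M ≤ n → c * (n * n * n) * 7 ^ n ≤ 8 ^ n
c*n³*7^n≤8^n-eventually c = c * 30 ^ 4 , λ n M≤n → *-cancelˡ-≤ (30 ^ 4) (begin
  30 ^ 4 * (c * (n * n * n) * 7 ^ n)  ≡⟨ regroup (30 ^ 4) c (n * n * n) (7 ^ n) ⟩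
  c * 30 ^ 4 * (n * n * n) * 7 ^ n    ≤⟨ *-monoˡ-≤ (7 ^ n) (*-monoˡ-≤ (n * n * n) M≤n) ⟩
  n * (n * n * n) * 7 ^ n             ≡⟨ cong (_* 7 ^ n) (fourth n) ⟩
  n ^ 4 * 7 ^ n                       ≤⟨ *-monoˡ-≤ (7 ^ n) (^-monoˡ-≤ 4 (m≤n+m n 30)) ⟩
  (30 + n) ^ 4 * 7 ^ n                ≡⟨ *-comm ((30 + n) ^ 4) (7 ^ n) ⟩
  7 ^ n * (30 + n) ^ 4                ≤⟨ 7^n*[30+n]⁴≤30⁴*8^n n ⟩
  30 ^ 4 * 8 ^ n                      ∎)
  where
  open ≤-Reasoning
  regroup : ∀ k c x y → k * (c * x * y) ≡ c * k * x * y
  regroup = solve-∀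
  fourth : ∀ n → n * (n * n * n) ≡ n * (n * (n * (n * 1)))
  fourth = solve-∀

k*highPotentialCount≤2^[m*m] : ∀ k m → 6 * k * (m * m * m) * 7 ^ m ≤ 8 ^ m → k * highPotentialCount m ≤ 2 ^ (m * m)
k*highPotentialCount≤2^[m*m] k m 6k*m³*7^m≤8^m = *-cancelˡ-≤ (8 ^ m) {{m^n≢0 8 m}} (begin
  8 ^ m * (k * #high)                          ≡⟨ *-left-comm (8 ^ m) k #high ⟩
  k * (8 ^ m * #high)                          ≤⟨ *-monoʳ-≤ k (8^m*highPotentialCount≤ m) ⟩
  k * (6 * (m * m * m) * 7 ^ m * 2 ^ (m * m))  ≡⟨ regroup k (m * m * m) (7 ^ m) (2 ^ (m * m)) ⟩
  6 * k * (m * m * m) * 7 ^ m * 2 ^ (m * m)    ≤⟨ *-monoˡ-≤ (2 ^ (m * m)) 6k*m³*7^m≤8^m ⟩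
  8 ^ m * 2 ^ (m * m)                          ∎)
  where
  open ≤-Reasoning
  #high : ℕ
  #high = highPotentialCount m
  regroup : ∀ k x y z → k * (6 * x * y * z) ≡ 6 * k * x * y * z
  regroup = solve-∀

[k∸1]*n≤k*l : ∀ k l b n → l + b ≡ n → k * b ≤ n → (k ∸ 1) * n ≤ k * l
[k∸1]*n≤k*l zero    l b n _       _     = z≤n
[k∸1]*n≤k*l (suc k) l b n l+b≡n k*b≤n = +-cancelʳ-≤ n (k * n) (suc k * l) (begin
  k * n + n              ≡⟨ +-comm (k * n) n ⟩
  suc k * n              ≡⟨ cong (suc k *_) l+b≡n ⟨
  suc k * (l + b)        ≡⟨ *-distribˡ-+ (suc k) l b ⟩
  suc k * l + suc k * b  ≤⟨ +-monoʳ-≤ (suc k * l) k*b≤n ⟩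
  suc k * l + n          ∎)
  where open ≤-Reasoning

probGoodAtLeast-byThreshold : ∀ k m (g : SignMatrix m → ℕ) t → (∀ X → ContainsBadSubmatrix m X → t ≤ g X) →
  k * length (filter (λ X → t ≤? g X) (signMatrices m m)) ≤ 2 ^ (m * m) → ProbGoodAtLeast k m
probGoodAtLeast-byThreshold k m g t bad⇒t≤g k*#high≤N =
  good ,
  filter⁺ (∁? t≤g?) (signMatrices-unique m m) ,
  All.map (λ t≰gX bad → t≰gX (bad⇒t≤g _ bad)) (all-filter (∁? t≤g?) (signMatrices m m)) ,
  [k∸1]*n≤k*l k (length good) _ _ (trans (length-filter-∁ t≤g? (signMatrices m m)) (length-signMatrices m)) k*#high≤N
  where
  t≤g? : ∀ X → Dec (t ≤ g X)
  t≤g? X = t ≤? g X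
  good : List (SignMatrix m)
  good = filter (∁? t≤g?) (signMatrices m m)

theorem4p10 : ∀ (k : ℕ) → ∃[ M ] (∀ (m : ℕ) → M ≤ m → ProbGoodAtLeast k m)
theorem4p10 k =
  let (M , 6k*m³*7^m≤8^m) = c*n³*7^n≤8^n-eventually (6 * k) in
  M , λ m M≤m →
    probGoodAtLeast-byThreshold k m symmetricPotential (4 ^ suc m) badSubmatrix⇒4^[1+m]≤symmetricPotential
      (k*highPotentialCount≤2^[m*m] k m (6k*m³*7^m≤8^m m M≤m))
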